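{- Let $n,m,k,\ell,c$ be positive integers with $k+\ell<n<m$, and consider the equation $x^n+y^m=c\,x^k y^\ell$ in positive integers $x,y$. (i) A pair $(x,y)$ of positive integers is a solution if and only if there exist positive integers $d,x_1,y_1,r,s$ with $\gcd(x_1,y_1)=1$ such that $x=dx_1$, $y=dy_1$ (so $d=\gcd(x,y)$), $d^{m-(k+\ell)}=r\,x_1^k$, $d^{n-(k+\ell)}=s\,y_1^\ell$, and $c=x_1^{n-k}\,s+y_1^{m-\ell}\,r$. (ii) If $c\in\{1,3,4,5\}$, the equation has no positive integer solutions. If $c=2$, the equation has the unique solution $(x,y)=(1,1)$. (iii) If $c=\rho^{m-(k+\ell)}+\rho^{n-(k+\ell)}$ for some positive integer $\rho$, then $(x,y)=(\rho,\rho)$ is a solution.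
   Context: A solution means an ordered pair $(x,y)$ of positive integers satisfying the equation. -}

module Defs where

open import Data.Nat using (ℕ; _+_; _*_; _^_; _<_)
open import Data.Product using (_×_)
open import Relation.Binary.PropositionalEquality using (_≡_)

Solution : (n m k ℓ c x y : ℕ) → Set
Solution n m k ℓ c x y = 0 < x × 0 < y × x ^ n + y ^ m ≡ c * (x ^ k) * (y ^ ℓ)

{-# OPTIONS --safe #-}
-- Put x = d x₁, y = d y₁ with d = gcd(x, y), and write n = k + ℓ + a, m = k + ℓ + b.
-- Dividing the equation by d^(k+ℓ) leaves d^a x₁^n + d^b y₁^m = c x₁^k y₁^ℓ. Since
-- x₁ and y₁ are coprime, x₁^k divides d^b and y₁^ℓ divides d^a; naming the cofactors
-- r and s and dividing once more by x₁^k y₁^ℓ gives c = x₁^(n-k) s + y₁^(m-ℓ) r.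
-- For d = 1 this forces x₁ = y₁ = r = s = 1 and c = 2. For d ≥ 2 we have
-- r x₁^k = d^b ≥ 4 and s y₁^ℓ = d^a ≥ 2 (as b > a ≥ 1), and a short case split on
-- whether x₁ and y₁ equal 1 shows that c ≥ 6.
module Submission where

open import Defs
open import Data.Nat using (ℕ; zero; suc; _+_; _*_; _^_; _∸_; _<_; _≤_; z≤n; s≤s; NonZero; >-nonZero; >-nonZero⁻¹; ≢-nonZero)
open import Data.Nat.Properties
open import Data.Nat.Divisibility using (_∣_; divides; ∣-trans; ∣1⇒≡1; ∣m+n∣m⇒∣n; m∣m*n; n∣m*n; n∣m*n*o)
open import Data.Nat.DivMod using (_/_; m*[n/m]≡n)
open import Data.Nat.GCD using (gcd; gcd[m,n]∣m; gcd[m,n]∣n; gcd[m,n]≢0; gcd-zeroˡ)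
open import Data.Nat.Coprimality as Coprimality using (Coprime; coprime-divisor; coprime-/gcd; coprime⇒gcd≡1)
open import Data.Nat.Tactic.RingSolver using (solve-∀)
open import Data.Product using (_×_; ∃-syntax; _,_)
open import Data.Sum using (_⊎_; inj₁; inj₂)
open import Relation.Nullary using (¬_; contradiction)
open import Relation.Binary.PropositionalEquality using (_≡_; _≢_; refl; sym; trans; cong; cong₂; subst; module ≡-Reasoning)
open import Function.Bundles using (_⇔_; mk⇔; module Equivalence)

open Equivalence using (to; from)

^-distrib-* : ∀ u v i → (u * v) ^ i ≡ u ^ i * v ^ i
^-distrib-* u v zero    = refl
^-distrib-* u v (suc i) = trans (cong (u * v *_) (^-distrib-* u v i)) (interchange u v (u ^ i) (v ^ i))
  where
  interchange : ∀ u v s t → u * v * (s * t) ≡ u * s * (v * t)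
  interchange = solve-∀

^-positive : ∀ {u} i → 0 < u → 0 < u ^ i
^-positive i u>0 = m^n>0 _ {{>-nonZero u>0}} i

*-positiveˡ : ∀ u {v} → 0 < u * v → 0 < u
*-positiveˡ u uv>0 = >-nonZero⁻¹ u {{m*n≢0⇒m≢0 u {{>-nonZero uv>0}}}}

*-positiveʳ : ∀ u {v} → 0 < u * v → 0 < v
*-positiveʳ u {v} uv>0 = >-nonZero⁻¹ v {{m*n≢0⇒n≢0 u {{>-nonZero uv>0}}}}

2^i≤u^j : ∀ {u i j} → 2 ≤ u → i ≤ j → 2 ^ i ≤ u ^ j
2^i≤u^j {j = j} u≥2 i≤j = ≤-trans (^-monoʳ-≤ 2 i≤j) (^-monoˡ-≤ j u≥2)

r*u^j≡1⇒u≡1 : ∀ r u j → 0 < j → r * u ^ j ≡ 1 → u ≡ 1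
r*u^j≡1⇒u≡1 r u j j>0 eq with m^n≡1⇒n≡0∨m≡1 u j (m*n≡1⇒n≡1 r (u ^ j) eq)
... | inj₁ j≡0 = contradiction j≡0 (n>0⇒n≢0 j>0)
... | inj₂ u≡1 = u≡1

∸-split : ∀ i j {n} → i + j ≤ n → n ∸ i ≡ j + (n ∸ (i + j))
∸-split i j {n} i+j≤n = begin
    n ∸ i             ≡⟨ m+[n∸m]≡n j≤n∸i ⟨
    j + (n ∸ i ∸ j)   ≡⟨ cong (j +_) (∸-+-assoc n i j) ⟩
    j + (n ∸ (i + j)) ∎
  where
  open ≡-Reasoning
  j≤n∸i : j ≤ n ∸ i
  j≤n∸i = m+n≤o⇒m≤o∸n j (subst (_≤ n) (+-comm i j) i+j≤n)

coprime-^ʳ : ∀ {u v} j → Coprime u v → Coprime u (v ^ j)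
coprime-^ʳ zero    _       (_ , i∣1)        = ∣1⇒≡1 i∣1
coprime-^ʳ {v = v} (suc j) coprime {i} (i∣u , i∣v*vʲ) =
  coprime-^ʳ j coprime (i∣u , coprime-divisor i⊥v i∣v*vʲ)
  where
  i⊥v : Coprime i v
  i⊥v (h∣i , h∣v) = coprime (∣-trans h∣i i∣u , h∣v)

coprime-^ : ∀ {u v} i j → Coprime u v → Coprime (u ^ i) (v ^ j)
coprime-^ i j coprime = Coprimality.sym (coprime-^ʳ i (Coprimality.sym (coprime-^ʳ j coprime)))

coprime-∣-summand : ∀ {u w s t} → Coprime u w → u ∣ s + t * w → u ∣ s → u ∣ t
coprime-∣-summand {u} {w} {t = t} coprime u∣s+t*w u∣s =
  coprime-divisor coprime (subst (u ∣_) (*-comm t w) (∣m+n∣m⇒∣n u∣s+t*w u∣s))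

gcd-decomposition : ∀ x y → 0 < x →
  ∃[ d ] ∃[ x₁ ] ∃[ y₁ ] (0 < d × Coprime x₁ y₁ × x ≡ d * x₁ × y ≡ d * y₁)
gcd-decomposition x y x>0 =
  gcd x y , x / gcd x y , y / gcd x y , >-nonZero⁻¹ (gcd x y) , coprime-/gcd x y ,
  sym (m*[n/m]≡n (gcd[m,n]∣m x y)) , sym (m*[n/m]≡n (gcd[m,n]∣n x y))
  where
  instance
    gcd≢0 : NonZero (gcd x y)
    gcd≢0 = ≢-nonZero (gcd[m,n]≢0 x y (inj₁ (n>0⇒n≢0 x>0)))

solution-at-one : ∀ n m k ℓ c → Solution n m k ℓ c 1 1 ⇔ c ≡ 2
solution-at-one n m k ℓ c = mk⇔
  (λ (_ , _ , e) → trans (sym rhs≡c) (trans (sym e) lhs≡2))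
  (λ c≡2 → s≤s z≤n , s≤s z≤n , trans lhs≡2 (trans (sym c≡2) (sym rhs≡c)))
  where
  lhs≡2 : 1 ^ n + 1 ^ m ≡ 2
  lhs≡2 = cong₂ _+_ (^-zeroˡ n) (^-zeroˡ m)
  rhs≡c : c * 1 ^ k * 1 ^ ℓ ≡ c
  rhs≡c = trans (cong₂ (λ u v → c * u * v) (^-zeroˡ k) (^-zeroˡ ℓ))
                (trans (*-identityʳ (c * 1)) (*-identityʳ c))

6≤A*s+B*r : ∀ {A B r s} → 0 < A → 0 < B → 0 < r → 0 < s →
  4 ≤ A ⊎ 4 ≤ r → 4 ≤ B ⊎ 2 ≤ s → 6 ≤ A * s + B * r
6≤A*s+B*r _ _ r>0 s>0 (inj₁ A≥4) (inj₁ B≥4) =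
  ≤-trans (m≤m+n 6 2) (+-mono-≤ (*-mono-≤ A≥4 s>0) (*-mono-≤ B≥4 r>0))
6≤A*s+B*r _ _ _ _ (inj₁ A≥4) (inj₂ s≥2) =
  ≤-trans (m≤m+n 6 2) (≤-trans (*-mono-≤ A≥4 s≥2) (m≤m+n _ _))
6≤A*s+B*r _ _ _ _ (inj₂ r≥4) (inj₁ B≥4) =
  ≤-trans (m≤m+n 6 10) (≤-trans (*-mono-≤ B≥4 r≥4) (m≤n+m _ _))
6≤A*s+B*r A>0 B>0 _ _ (inj₂ r≥4) (inj₂ s≥2) =
  +-mono-≤ (*-mono-≤ A>0 s≥2) (*-mono-≤ B>0 r≥4)

large-power-or-large-cofactor : ∀ {D r t} u j i → 2 ≤ i → 0 < u →
  D ≡ r * u ^ j → t ≤ D → 4 ≤ u ^ i ⊎ t ≤ r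
large-power-or-large-cofactor {r = r} {t} (suc zero) j _ _ _ D≡ t≤D =
  inj₂ (subst (t ≤_) (trans D≡ (trans (cong (r *_) (^-zeroˡ j)) (*-identityʳ r))) t≤D)
large-power-or-large-cofactor (suc (suc _)) _ _ i≥2 _ _ _ =
  inj₁ (2^i≤u^j (s≤s (s≤s z≤n)) i≥2)

excluded-values : ∀ {c} → c ≡ 1 ⊎ c ≡ 3 ⊎ c ≡ 4 ⊎ c ≡ 5 → c ≢ 2 × c < 6
excluded-values (inj₁ refl)                = (λ ()) , m≤m+n 2 4
excluded-values (inj₂ (inj₁ refl))         = (λ ()) , m≤m+n 4 2
excluded-values (inj₂ (inj₂ (inj₁ refl)))  = (λ ()) , m≤m+n 5 1
excluded-values (inj₂ (inj₂ (inj₂ refl)))  = (λ ()) , ≤-refl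

-- p = n - k, q = m - ℓ, a = n - (k + ℓ) and b = m - (k + ℓ), kept as separate
-- variables tied by equations so that no truncated subtraction occurs below.
module Exponents (k ℓ a b : ℕ) {n m p q : ℕ}
  (n≡k+p : n ≡ k + p) (p≡ℓ+a : p ≡ ℓ + a) (m≡ℓ+q : m ≡ ℓ + q) (q≡k+b : q ≡ k + b) where

  Parametrisation : (c x y : ℕ) → Set
  Parametrisation c x y = ∃[ d ] ∃[ x₁ ] ∃[ y₁ ] ∃[ r ] ∃[ s ]
    (0 < d × 0 < x₁ × 0 < y₁ × 0 < r × 0 < s × gcd x₁ y₁ ≡ 1 ×
     x ≡ d * x₁ × y ≡ d * y₁ ×
     d ^ b ≡ r * x₁ ^ k × d ^ a ≡ s * y₁ ^ ℓ ×
     c ≡ x₁ ^ p * s + y₁ ^ q * r)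

  Reduced : (c d x₁ y₁ : ℕ) → Set
  Reduced c d x₁ y₁ = d ^ a * x₁ ^ n + d ^ b * y₁ ^ m ≡ c * x₁ ^ k * y₁ ^ ℓ

  ^n≡^k*^p : ∀ u → u ^ n ≡ u ^ k * u ^ p
  ^n≡^k*^p u = trans (cong (u ^_) n≡k+p) (^-distribˡ-+-* u k p)

  ^m≡^ℓ*^q : ∀ u → u ^ m ≡ u ^ ℓ * u ^ q
  ^m≡^ℓ*^q u = trans (cong (u ^_) m≡ℓ+q) (^-distribˡ-+-* u ℓ q)

  ^n≡^[k+ℓ]*^a : ∀ u → u ^ n ≡ u ^ (k + ℓ) * u ^ a
  ^n≡^[k+ℓ]*^a u = begin
    u ^ n                 ≡⟨ cong (u ^_) (trans n≡k+p (cong (k +_) p≡ℓ+a)) ⟩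
    u ^ (k + (ℓ + a))     ≡⟨ cong (u ^_) (+-assoc k ℓ a) ⟨
    u ^ (k + ℓ + a)       ≡⟨ ^-distribˡ-+-* u (k + ℓ) a ⟩
    u ^ (k + ℓ) * u ^ a   ∎
    where open ≡-Reasoning

  ^m≡^[k+ℓ]*^b : ∀ u → u ^ m ≡ u ^ (k + ℓ) * u ^ b
  ^m≡^[k+ℓ]*^b u = begin
    u ^ m                 ≡⟨ cong (u ^_) (trans m≡ℓ+q (cong (ℓ +_) q≡k+b)) ⟩
    u ^ (ℓ + (k + b))     ≡⟨ cong (u ^_) (trans (cong (_+ b) (+-comm k ℓ)) (+-assoc ℓ k b)) ⟨
    u ^ (k + ℓ + b)       ≡⟨ ^-distribˡ-+-* u (k + ℓ) b ⟩
    u ^ (k + ℓ) * u ^ b   ∎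
    where open ≡-Reasoning

  scaled-lhs : ∀ d x₁ y₁ →
    (d * x₁) ^ n + (d * y₁) ^ m ≡ d ^ (k + ℓ) * (d ^ a * x₁ ^ n + d ^ b * y₁ ^ m)
  scaled-lhs d x₁ y₁ = begin
    (d * x₁) ^ n + (d * y₁) ^ m
      ≡⟨ cong₂ _+_ (^-distrib-* d x₁ n) (^-distrib-* d y₁ m) ⟩
    d ^ n * x₁ ^ n + d ^ m * y₁ ^ m
      ≡⟨ cong₂ (λ u v → u * x₁ ^ n + v * y₁ ^ m) (^n≡^[k+ℓ]*^a d) (^m≡^[k+ℓ]*^b d) ⟩
    d ^ (k + ℓ) * d ^ a * x₁ ^ n + d ^ (k + ℓ) * d ^ b * y₁ ^ m
      ≡⟨ factor (d ^ (k + ℓ)) (d ^ a) (d ^ b) (x₁ ^ n) (y₁ ^ m) ⟩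
    d ^ (k + ℓ) * (d ^ a * x₁ ^ n + d ^ b * y₁ ^ m) ∎
    where
    open ≡-Reasoning
    factor : ∀ D A B X Y → D * A * X + D * B * Y ≡ D * (A * X + B * Y)
    factor = solve-∀

  scaled-rhs : ∀ c d x₁ y₁ →
    c * (d * x₁) ^ k * (d * y₁) ^ ℓ ≡ d ^ (k + ℓ) * (c * x₁ ^ k * y₁ ^ ℓ)
  scaled-rhs c d x₁ y₁ = begin
    c * (d * x₁) ^ k * (d * y₁) ^ ℓ
      ≡⟨ cong₂ (λ u v → c * u * v) (^-distrib-* d x₁ k) (^-distrib-* d y₁ ℓ) ⟩
    c * (d ^ k * x₁ ^ k) * (d ^ ℓ * y₁ ^ ℓ)
      ≡⟨ factor c (d ^ k) (d ^ ℓ) (x₁ ^ k) (y₁ ^ ℓ) ⟩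
    d ^ k * d ^ ℓ * (c * x₁ ^ k * y₁ ^ ℓ)
      ≡⟨ cong (_* (c * x₁ ^ k * y₁ ^ ℓ)) (^-distribˡ-+-* d k ℓ) ⟨
    d ^ (k + ℓ) * (c * x₁ ^ k * y₁ ^ ℓ) ∎
    where
    open ≡-Reasoning
    factor : ∀ c K L X Y → c * (K * X) * (L * Y) ≡ K * L * (c * X * Y)
    factor = solve-∀

  scaled⇔reduced : ∀ {c d x₁ y₁} → 0 < d →
    (d * x₁) ^ n + (d * y₁) ^ m ≡ c * (d * x₁) ^ k * (d * y₁) ^ ℓ ⇔ Reduced c d x₁ y₁
  scaled⇔reduced {c} {d} {x₁} {y₁} d>0 = mk⇔
    (λ e → *-cancelˡ-≡ _ _ (d ^ (k + ℓ)) {{>-nonZero (^-positive (k + ℓ) d>0)}}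
             (trans (sym (scaled-lhs d x₁ y₁)) (trans e (scaled-rhs c d x₁ y₁))))
    (λ e → trans (scaled-lhs d x₁ y₁)
             (trans (cong (d ^ (k + ℓ) *_) e) (sym (scaled-rhs c d x₁ y₁))))

  reduced⇒∣ : ∀ {c d x₁ y₁} → Coprime x₁ y₁ → Reduced c d x₁ y₁ →
    x₁ ^ k ∣ d ^ b × y₁ ^ ℓ ∣ d ^ a
  reduced⇒∣ {c} {d} {x₁} {y₁} coprime e =
    coprime-∣-summand (coprime-^ k m coprime)
      (subst (x₁ ^ k ∣_) (sym e) (n∣m*n*o c (y₁ ^ ℓ))) x₁ᵏ∣dᵃx₁ⁿ ,
    coprime-∣-summand (coprime-^ ℓ n (Coprimality.sym coprime))
      (subst (y₁ ^ ℓ ∣_) (trans (sym e) (+-comm (d ^ a * x₁ ^ n) _)) (n∣m*n (c * x₁ ^ k)))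
      y₁ˡ∣dᵇy₁ᵐ
    where
    x₁ᵏ∣dᵃx₁ⁿ : x₁ ^ k ∣ d ^ a * x₁ ^ n
    x₁ᵏ∣dᵃx₁ⁿ = ∣-trans (subst (x₁ ^ k ∣_) (sym (^n≡^k*^p x₁)) (m∣m*n (x₁ ^ p))) (n∣m*n (d ^ a))
    y₁ˡ∣dᵇy₁ᵐ : y₁ ^ ℓ ∣ d ^ b * y₁ ^ m
    y₁ˡ∣dᵇy₁ᵐ = ∣-trans (subst (y₁ ^ ℓ ∣_) (sym (^m≡^ℓ*^q y₁)) (m∣m*n (y₁ ^ q))) (n∣m*n (d ^ b))

  reduced-lhs-factor : ∀ {d x₁ y₁ r s} → d ^ b ≡ r * x₁ ^ k → d ^ a ≡ s * y₁ ^ ℓ →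
    d ^ a * x₁ ^ n + d ^ b * y₁ ^ m ≡ (x₁ ^ p * s + y₁ ^ q * r) * x₁ ^ k * y₁ ^ ℓ
  reduced-lhs-factor {d} {x₁} {y₁} {r} {s} dᵇ≡ dᵃ≡ = begin
    d ^ a * x₁ ^ n + d ^ b * y₁ ^ m
      ≡⟨ cong₂ (λ u v → d ^ a * u + d ^ b * v) (^n≡^k*^p x₁) (^m≡^ℓ*^q y₁) ⟩
    d ^ a * (x₁ ^ k * x₁ ^ p) + d ^ b * (y₁ ^ ℓ * y₁ ^ q)
      ≡⟨ cong₂ (λ u v → u * (x₁ ^ k * x₁ ^ p) + v * (y₁ ^ ℓ * y₁ ^ q)) dᵃ≡ dᵇ≡ ⟩
    s * y₁ ^ ℓ * (x₁ ^ k * x₁ ^ p) + r * x₁ ^ k * (y₁ ^ ℓ * y₁ ^ q)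
      ≡⟨ factor (x₁ ^ k) (y₁ ^ ℓ) (x₁ ^ p) (y₁ ^ q) r s ⟩
    (x₁ ^ p * s + y₁ ^ q * r) * x₁ ^ k * y₁ ^ ℓ ∎
    where
    open ≡-Reasoning
    factor : ∀ X Y X' Y' r s → s * Y * (X * X') + r * X * (Y * Y') ≡ (X' * s + Y' * r) * X * Y
    factor = solve-∀

  reduced⇔cofactor-sum : ∀ {c d x₁ y₁ r s} → 0 < x₁ → 0 < y₁ →
    d ^ b ≡ r * x₁ ^ k → d ^ a ≡ s * y₁ ^ ℓ →
    Reduced c d x₁ y₁ ⇔ c ≡ x₁ ^ p * s + y₁ ^ q * r
  reduced⇔cofactor-sum {c} {d} {x₁} {y₁} {r} {s} x₁>0 y₁>0 dᵇ≡ dᵃ≡ = mk⇔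
    (λ e → sym (*-cancelʳ-≡ _ _ (x₁ ^ k) {{>-nonZero (^-positive k x₁>0)}}
             (*-cancelʳ-≡ _ _ (y₁ ^ ℓ) {{>-nonZero (^-positive ℓ y₁>0)}}
               (trans (sym (reduced-lhs-factor dᵇ≡ dᵃ≡)) e))))
    (λ c≡ → trans (reduced-lhs-factor dᵇ≡ dᵃ≡) (cong (λ t → t * x₁ ^ k * y₁ ^ ℓ) (sym c≡)))

  solution⇒parametrisation : ∀ {c x y} → Solution n m k ℓ c x y → Parametrisation c x y
  solution⇒parametrisation {c} {x} {y} (x>0 , y>0 , e) with gcd-decomposition x y x>0
  ... | d , x₁ , y₁ , d>0 , coprime , refl , refl
    with reduced⇒∣ {c} coprime (to (scaled⇔reduced {c} d>0) e)
  ... | divides r dᵇ≡ , divides s dᵃ≡ =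
    d , x₁ , y₁ , r , s , d>0 , x₁>0 , y₁>0 ,
    *-positiveˡ r (subst (0 <_) dᵇ≡ (^-positive b d>0)) ,
    *-positiveˡ s (subst (0 <_) dᵃ≡ (^-positive a d>0)) ,
    coprime⇒gcd≡1 coprime , refl , refl , dᵇ≡ , dᵃ≡ ,
    to (reduced⇔cofactor-sum x₁>0 y₁>0 dᵇ≡ dᵃ≡) (to (scaled⇔reduced {c} d>0) e)
    where
    x₁>0 : 0 < x₁
    x₁>0 = *-positiveʳ d x>0
    y₁>0 : 0 < y₁
    y₁>0 = *-positiveʳ d y>0

  parametrisation⇒solution : ∀ {c x y} → Parametrisation c x y → Solution n m k ℓ c x y
  parametrisation⇒solution {c}
    (d , x₁ , y₁ , r , s , d>0 , x₁>0 , y₁>0 , _ , _ , _ , refl , refl , dᵇ≡ , dᵃ≡ , c≡) =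
    *-mono-≤ d>0 x₁>0 , *-mono-≤ d>0 y₁>0 ,
    from (scaled⇔reduced {c} d>0) (from (reduced⇔cofactor-sum {c} x₁>0 y₁>0 dᵇ≡ dᵃ≡) c≡)

  solution⇔parametrisation : ∀ {c} x y → Solution n m k ℓ c x y ⇔ Parametrisation c x y
  solution⇔parametrisation x y = mk⇔ solution⇒parametrisation parametrisation⇒solution

  diagonal-solution : ∀ {c} ρ → 0 < ρ → c ≡ ρ ^ b + ρ ^ a → Solution n m k ℓ c ρ ρ
  diagonal-solution ρ ρ>0 c≡ = parametrisation⇒solution
    (ρ , 1 , 1 , ρ ^ b , ρ ^ a , ρ>0 , s≤s z≤n , s≤s z≤n , ^-positive b ρ>0 , ^-positive a ρ>0 ,
     gcd-zeroˡ 1 , sym (*-identityʳ ρ) , sym (*-identityʳ ρ) ,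
     sym (*1^ (ρ ^ b) k) , sym (*1^ (ρ ^ a) ℓ) ,
     trans c≡ (trans (+-comm (ρ ^ b) (ρ ^ a))
       (sym (cong₂ _+_ (trans (*-comm (1 ^ p) _) (*1^ (ρ ^ a) p))
                       (trans (*-comm (1 ^ q) _) (*1^ (ρ ^ b) q))))))
    where
    *1^ : ∀ u j → u * 1 ^ j ≡ u
    *1^ u j = trans (cong (u *_) (^-zeroˡ j)) (*-identityʳ u)

  module _ (k>0 : 0 < k) (ℓ>0 : 0 < ℓ) (a>0 : 0 < a) (b≥2 : 2 ≤ b) where

    parametrisation⇒unit-or-≥6 : ∀ {c x y} → Parametrisation c x y → (x ≡ 1 × y ≡ 1) ⊎ 6 ≤ c
    parametrisation⇒unit-or-≥6
      (1 , x₁ , y₁ , r , s , _ , _ , _ , _ , _ , _ , refl , refl , 1ᵇ≡ , 1ᵃ≡ , _) =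
      inj₁ (trans (*-identityˡ x₁) (r*u^j≡1⇒u≡1 r x₁ k k>0 (trans (sym 1ᵇ≡) (^-zeroˡ b))) ,
            trans (*-identityˡ y₁) (r*u^j≡1⇒u≡1 s y₁ ℓ ℓ>0 (trans (sym 1ᵃ≡) (^-zeroˡ a))))
    parametrisation⇒unit-or-≥6
      (d@(suc (suc _)) , x₁ , y₁ , r , s , _ , x₁>0 , y₁>0 , r>0 , s>0 , _ , _ , _ , dᵇ≡ , dᵃ≡ , c≡) =
      inj₂ (subst (6 ≤_) (sym c≡)
        (6≤A*s+B*r (^-positive p x₁>0) (^-positive q y₁>0) r>0 s>0
          (large-power-or-large-cofactor x₁ k p p≥2 x₁>0 dᵇ≡ (2^i≤u^j d≥2 b≥2))
          (large-power-or-large-cofactor y₁ ℓ q q≥2 y₁>0 dᵃ≡ (2^i≤u^j d≥2 a>0))))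
      where
      d≥2 : 2 ≤ d
      d≥2 = s≤s (s≤s z≤n)
      p≥2 : 2 ≤ p
      p≥2 = subst (2 ≤_) (sym p≡ℓ+a) (+-mono-≤ ℓ>0 a>0)
      q≥2 : 2 ≤ q
      q≥2 = subst (2 ≤_) (sym q≡k+b) (≤-trans b≥2 (m≤n+m b k))

    solution⇒unit-or-≥6 : ∀ {c x y} → Solution n m k ℓ c x y → (x ≡ 1 × y ≡ 1) ⊎ 6 ≤ c
    solution⇒unit-or-≥6 sol = parametrisation⇒unit-or-≥6 (solution⇒parametrisation sol)

    no-solution : ∀ {c} → c ≡ 1 ⊎ c ≡ 3 ⊎ c ≡ 4 ⊎ c ≡ 5 → (x y : ℕ) → ¬ Solution n m k ℓ c x y
    no-solution {c} c∈ x y sol with excluded-values c∈ | solution⇒unit-or-≥6 sol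
    ... | c≢2 , _   | inj₁ (refl , refl) = c≢2 (to (solution-at-one n m k ℓ c) sol)
    ... | _   , c<6 | inj₂ c≥6           = <⇒≱ c<6 c≥6

    unique-solution : ∀ {c} → c ≡ 2 → (x y : ℕ) → Solution n m k ℓ c x y ⇔ (x ≡ 1 × y ≡ 1)
    unique-solution refl x y = mk⇔ solution⇒unit unit⇒solution
      where
      solution⇒unit : Solution n m k ℓ 2 x y → x ≡ 1 × y ≡ 1
      solution⇒unit sol with solution⇒unit-or-≥6 sol
      ... | inj₁ unit = unit
      ... | inj₂ 2≥6  = contradiction 2≥6 (<⇒≱ (m≤m+n 3 3))
      unit⇒solution : x ≡ 1 × y ≡ 1 → Solution n m k ℓ 2 x y
      unit⇒solution (refl , refl) = from (solution-at-one n m k ℓ 2) refl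

theorem3 : (n m k ℓ c : ℕ) → 0 < n → 0 < m → 0 < k → 0 < ℓ → 0 < c →
    k + ℓ < n → n < m →
    ((x y : ℕ) → Solution n m k ℓ c x y ⇔
        (∃[ d ] ∃[ x₁ ] ∃[ y₁ ] ∃[ r ] ∃[ s ]
          (0 < d × 0 < x₁ × 0 < y₁ × 0 < r × 0 < s × gcd x₁ y₁ ≡ 1 ×
           x ≡ d * x₁ × y ≡ d * y₁ ×
           d ^ (m ∸ (k + ℓ)) ≡ r * x₁ ^ k ×
           d ^ (n ∸ (k + ℓ)) ≡ s * y₁ ^ ℓ ×
           c ≡ x₁ ^ (n ∸ k) * s + y₁ ^ (m ∸ ℓ) * r)))
    × ((c ≡ 1 ⊎ c ≡ 3 ⊎ c ≡ 4 ⊎ c ≡ 5) → (x y : ℕ) → ¬ Solution n m k ℓ c x y)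
    × (c ≡ 2 → (x y : ℕ) → Solution n m k ℓ c x y ⇔ (x ≡ 1 × y ≡ 1))
    × ((ρ : ℕ) → 0 < ρ → c ≡ ρ ^ (m ∸ (k + ℓ)) + ρ ^ (n ∸ (k + ℓ)) →
        Solution n m k ℓ c ρ ρ)
theorem3 n m k ℓ c _ _ k>0 ℓ>0 _ k+ℓ<n n<m =
  solution⇔parametrisation , no-solution k>0 ℓ>0 a>0 b≥2 ,
  unique-solution k>0 ℓ>0 a>0 b≥2 , diagonal-solution
  where
  k+ℓ≤n : k + ℓ ≤ n
  k+ℓ≤n = <⇒≤ k+ℓ<n
  k+ℓ≤m : k + ℓ ≤ m
  k+ℓ≤m = ≤-trans k+ℓ≤n (<⇒≤ n<m)
  a>0 : 0 < n ∸ (k + ℓ)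
  a>0 = m<n⇒0<n∸m k+ℓ<n
  b≥2 : 2 ≤ m ∸ (k + ℓ)
  b≥2 = ≤-trans (s≤s a>0) (∸-monoˡ-< n<m k+ℓ≤n)
  n≡k+p : n ≡ k + (n ∸ k)
  n≡k+p = sym (m+[n∸m]≡n (m+n≤o⇒m≤o k k+ℓ≤n))
  p≡ℓ+a : n ∸ k ≡ ℓ + (n ∸ (k + ℓ))
  p≡ℓ+a = ∸-split k ℓ k+ℓ≤n
  m≡ℓ+q : m ≡ ℓ + (m ∸ ℓ)
  m≡ℓ+q = sym (m+[n∸m]≡n (m+n≤o⇒n≤o k k+ℓ≤m))
  q≡k+b : m ∸ ℓ ≡ k + (m ∸ (k + ℓ))
  q≡k+b = trans (∸-split ℓ k (subst (_≤ m) (+-comm k ℓ) k+ℓ≤m))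
                (cong (λ t → k + (m ∸ t)) (+-comm ℓ k))
  open Exponents k ℓ (n ∸ (k + ℓ)) (m ∸ (k + ℓ)) n≡k+p p≡ℓ+a m≡ℓ+q q≡k+b
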